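{- Let $k\ge 2$. For $1\le i\le k-1$ define rational numbers $b^k_{i,j}$ ($1\le j\le k-1$) by the polynomial identity \[ \sum_{j=1}^{k-1}\frac{b^k_{i,j}}{j!}\,t^j = \binom{t+k-1-i}{k-1}. \] Then for every $1\le i\le k-1$, \[ t^i = \sum_{j=2}^{k} b^k_{i,j-1}\,(1-t)^{k-j}\, Q^E_j(t). \]
   Context: Here $\binom{t+k-1-i}{k-1}$ denotes the polynomial $\frac{1}{(k-1)!}\prod_{m=0}^{k-2}(t+k-1-i-m)$ in $t$. The Eulerian polynomials $P_{s-1}(t)$, $s\ge1$, are defined by $\frac{tP_{s-1}(t)}{(1-t)^s}=\sum_{d=1}^\infty d^{s-1}t^d$, and $Q^E_j(t)=\frac{1}{(j-1)!}\,t\,P_{j-1}(t)$ for $j\ge1$. -}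

module Defs where

open import Data.Nat as ℕ using (ℕ; zero; suc; _∸_; _!)
open import Data.Nat.Properties using (_!≢0)
open import Data.Integer using (+_)
open import Data.Rational using (ℚ; 0ℚ; 1ℚ; _+_; _*_; _-_; -_; _/_)

-- Formal power series over ℚ, given by their coefficient sequences.
-- Polynomials are the finitely supported ones; equality is coefficientwise.
Series : Set
Series = ℕ → ℚ

sumTo : ℕ → (ℕ → ℚ) → ℚ
sumTo zero    f = f 0
sumTo (suc n) f = sumTo n f + f (suc n)

sumN : ℕ → (ℕ → ℚ) → ℚ
sumN zero    f = 0ℚ
sumN (suc c) f = sumN c f + f c

sumFromTo : ℕ → ℕ → (ℕ → ℚ) → ℚ
sumFromTo a b f = sumN (suc b ∸ a) (λ l → f (a ℕ.+ l))

fromℕ : ℕ → ℚ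
fromℕ n = + n / 1

const : ℚ → Series
const c zero    = c
const c (suc n) = 0ℚ

X : Series
X 1 = 1ℚ
X _ = 0ℚ

_⊕_ : Series → Series → Series
(f ⊕ g) n = f n + g n

_⊗_ : Series → Series → Series
(f ⊗ g) n = sumTo n (λ l → f l * g (n ∸ l))

scale : ℚ → Series → Series
scale c f n = c * f n

pow : Series → ℕ → Series
pow f zero    = const 1ℚ
pow f (suc n) = f ⊗ pow f n

sumSeries : ℕ → ℕ → (ℕ → Series) → Series
sumSeries a b F n = sumFromTo a b (λ j → F j n)

oneMinusT : Series
oneMinusT = const 1ℚ ⊕ scale (- 1ℚ) X

invFact : ℕ → ℚ
invFact m = (+ 1 / (m !)) {{m !≢0}}

prodSeries : ℕ → (ℕ → Series) → Series
prodSeries zero    F = const 1ℚ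
prodSeries (suc n) F = prodSeries n F ⊗ F n

-- the polynomial  binom(t+k-1-i, k-1) = 1/(k-1)! Π_{m=0}^{k-2} (t + (k-1-i-m))
binomPoly : ℕ → ℕ → Series
binomPoly k i = scale (invFact (k ∸ 1))
  (prodSeries (k ∸ 1) (λ m → X ⊕ const (fromℕ (k ∸ 1) - fromℕ i - fromℕ m)))

-- b^k_{i,j}: defined by  Σ_{j=1}^{k-1} b^k_{i,j}/j! t^j = binom(t+k-1-i, k-1),
-- i.e. b^k_{i,j} = j! · [t^j] binom(t+k-1-i, k-1).
b : ℕ → ℕ → ℕ → ℚ
b k i j = fromℕ (j !) * binomPoly k i j

eulerGF : ℕ → Series
eulerGF s zero    = 0ℚ
eulerGF s (suc d) = fromℕ (suc d ℕ.^ (s ∸ 1))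

-- t·P_{s-1}(t), defined by  t P_{s-1}(t) / (1-t)^s = Σ_{d≥1} d^{s-1} t^d,
-- i.e. t P_{s-1}(t) = (1-t)^s · Σ_{d≥1} d^{s-1} t^d.
tEulerian : ℕ → Series
tEulerian s = pow oneMinusT s ⊗ eulerGF s

-- Q^E_j(t) = 1/(j-1)! · t · P_{j-1}(t)
QE : ℕ → Series
QE j = scale (invFact (j ∸ 1)) (tEulerian j)

-- Everything is read on coefficient sequences.  Multiplication by t is the
-- shift  (shift A) n = A (n-1),  and multiplication by 1-t is the backward
-- difference  Δ A = A - shift A.  Hence t^i = shift^i 1 and
-- (1-t)^m · A = Δ^m A.  Because t P_{j-1}(t) = (1-t)^j Σ_d d^{j-1} t^d, the j-th
-- summand of the right-hand side equals  Δ^k  of the sequence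
-- d ↦ (b^k_{i,j-1}/(j-1)!) d^{j-1}, so the whole sum is Δ^k G with
-- G(d) = Σ_j (b^k_{i,j}/j!) d^j = binom(d+k-1-i, k-1), the defining polynomial
-- evaluated at d.  Evaluating the product of linear factors shows that G is the
-- i-fold shift of the binomial sequence H_{k-1}(e) = binom(e+k-1, k-1), and
-- Pascal's rule  Δ H_{n+1} = H_n  gives  Δ^k H_{k-1} = 1.  So the sum is
-- shift^i 1 = t^i.
module Submission where

open import Data.Nat using (ℕ; _≤_; _∸_)
open import Relation.Binary.PropositionalEquality using (_≡_)
open import Defs
open import Data.Nat as ℕ using (zero; suc; _!; _<_; z≤n; s≤s)
import Data.Nat.Properties as ℕₚ
open import Data.Nat.Coprimality as Coprime using (1-coprimeTo)
open import Data.Integer as ℤ using (+_)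
import Data.Integer.Properties as ℤₚ
open import Data.Rational using (ℚ; mkℚ; 0ℚ; 1ℚ; _+_; _*_; _-_; -_; _/_)
open import Data.Rational.Properties
open import Relation.Binary.PropositionalEquality
  using (refl; sym; trans; cong; cong₂; module ≡-Reasoning)
open import Relation.Nullary using (yes; no)
open import Data.Rational.Solver using (module +-*-Solver)
open +-*-Solver

-- The normalised rational n/1, on which ℚ-arithmetic computes.
natℚ : ℕ → ℚ
natℚ n = mkℚ (+ n) 0 (Coprime.sym (1-coprimeTo n))

fromℕ-normal : ∀ n → fromℕ n ≡ natℚ n
fromℕ-normal n = ↥p/↧p≡p (natℚ n)

fromℕ-+ : ∀ m n → fromℕ (m ℕ.+ n) ≡ fromℕ m + fromℕ n
fromℕ-+ m n = begin
    (+ (m ℕ.+ n)) / 1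
  ≡⟨ cong (_/ 1) (cong₂ ℤ._+_ (ℤₚ.*-identityʳ (+ m)) (ℤₚ.*-identityʳ (+ n))) ⟨
    (+ m ℤ.* + 1 ℤ.+ + n ℤ.* + 1) / 1
  ≡⟨⟩
    natℚ m + natℚ n
  ≡⟨ cong₂ _+_ (fromℕ-normal m) (fromℕ-normal n) ⟨
    fromℕ m + fromℕ n ∎
  where open ≡-Reasoning

fromℕ-* : ∀ m n → fromℕ (m ℕ.* n) ≡ fromℕ m * fromℕ n
fromℕ-* m n = begin
    (+ (m ℕ.* n)) / 1
  ≡⟨ cong (_/ 1) (ℤₚ.pos-* m n) ⟩
    natℚ m * natℚ n
  ≡⟨ cong₂ _*_ (fromℕ-normal m) (fromℕ-normal n) ⟨
    fromℕ m * fromℕ n ∎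
  where open ≡-Reasoning

fromℕ-suc : ∀ n → fromℕ (suc n) ≡ fromℕ n + 1ℚ
fromℕ-suc n = trans (cong fromℕ (ℕₚ.+-comm 1 n)) (fromℕ-+ n 1)

invFact-inverse : ∀ m → invFact m * fromℕ (m !) ≡ 1ℚ
invFact-inverse m = inverse (m !) {{m ℕₚ.!≢0}}
  where
    inverse : ∀ q .{{_ : ℕ.NonZero q}} → (+ 1 / q) * fromℕ q ≡ 1ℚ
    inverse (suc q) = begin
        (+ 1 / suc q) * fromℕ (suc q)
      ≡⟨ cong₂ _*_ (↥p/↧p≡p (mkℚ (+ 1) q (1-coprimeTo (suc q)))) (fromℕ-normal (suc q)) ⟩
        mkℚ (+ 1) q (1-coprimeTo (suc q)) * natℚ (suc q)
      ≡⟨ *-inverseˡ (natℚ (suc q)) ⟩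
        1ℚ ∎
      where open ≡-Reasoning

invFact-suc : ∀ n → fromℕ (suc n) * invFact (suc n) ≡ invFact n
invFact-suc n = begin
    s * c
  ≡⟨ *-identityˡ (s * c) ⟨
    1ℚ * (s * c)
  ≡⟨ cong (_* (s * c)) (invFact-inverse n) ⟨
    a * f * (s * c)
  ≡⟨ solve 4 (λ a f s c → a :* f :* (s :* c) := a :* (c :* (s :* f))) refl a f s c ⟩
    a * (c * (s * f))
  ≡⟨ cong (λ z → a * (c * z)) (fromℕ-* (suc n) (n !)) ⟨
    a * (c * fromℕ (suc n !))
  ≡⟨ cong (a *_) (invFact-inverse (suc n)) ⟩
    a * 1ℚ
  ≡⟨ *-identityʳ a ⟩
    a ∎
  where
    open ≡-Reasoning
    s = fromℕ (suc n)
    c = invFact (suc n)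
    a = invFact n
    f = fromℕ (n !)

sumTo-cong : ∀ n {f g : ℕ → ℚ} → (∀ l → l ≤ n → f l ≡ g l) → sumTo n f ≡ sumTo n g
sumTo-cong zero    f≗g = f≗g 0 z≤n
sumTo-cong (suc n) f≗g =
  cong₂ _+_ (sumTo-cong n (λ l l≤n → f≗g l (ℕₚ.m≤n⇒m≤1+n l≤n))) (f≗g (suc n) ℕₚ.≤-refl)

sumTo-zero : ∀ n (f : ℕ → ℚ) → (∀ l → l ≤ n → f l ≡ 0ℚ) → sumTo n f ≡ 0ℚ
sumTo-zero n f f≗0 = trans (sumTo-cong n f≗0) (zeros n)
  where
    zeros : ∀ n → sumTo n (λ _ → 0ℚ) ≡ 0ℚ
    zeros zero    = refl
    zeros (suc n) = cong (_+ 0ℚ) (zeros n)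

sumTo-+ : ∀ n (f g : ℕ → ℚ) → sumTo n (λ l → f l + g l) ≡ sumTo n f + sumTo n g
sumTo-+ zero    f g = refl
sumTo-+ (suc n) f g = trans (cong (_+ (f (suc n) + g (suc n))) (sumTo-+ n f g))
  (solve 4 (λ a b c d → (a :+ b) :+ (c :+ d) := (a :+ c) :+ (b :+ d)) refl
    (sumTo n f) (sumTo n g) (f (suc n)) (g (suc n)))

sumTo-* : ∀ n c (f : ℕ → ℚ) → sumTo n (λ l → c * f l) ≡ c * sumTo n f
sumTo-* zero    c f = refl
sumTo-* (suc n) c f = trans (cong (_+ c * f (suc n)) (sumTo-* n c f)) (sym (*-distribˡ-+ c _ _))

sumTo-first : ∀ n (f : ℕ → ℚ) → sumTo (suc n) f ≡ f 0 + sumTo n (λ l → f (suc l))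
sumTo-first zero    f = refl
sumTo-first (suc n) f = trans (cong (_+ f (suc (suc n))) (sumTo-first n f))
  (+-assoc (f 0) (sumTo n (λ l → f (suc l))) (f (suc (suc n))))

sumTo-last : ∀ n (f : ℕ → ℚ) → (∀ l → l < n → f l ≡ 0ℚ) → sumTo n f ≡ f n
sumTo-last zero    f f≗0 = refl
sumTo-last (suc n) f f≗0 =
  trans (cong (_+ f (suc n)) (sumTo-zero n f (λ l l≤n → f≗0 l (s≤s l≤n)))) (+-identityˡ (f (suc n)))

sumTo-sumN : ∀ n (f : ℕ → ℚ) → sumTo n f ≡ f 0 + sumN n (λ l → f (suc l))
sumTo-sumN zero    f = sym (+-identityʳ (f 0))
sumTo-sumN (suc n) f = trans (cong (_+ f (suc n)) (sumTo-sumN n f))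
  (+-assoc (f 0) (sumN n (λ l → f (suc l))) (f (suc n)))

sumN-cong : ∀ n {f g : ℕ → ℚ} → (∀ l → l < n → f l ≡ g l) → sumN n f ≡ sumN n g
sumN-cong zero    f≗g = refl
sumN-cong (suc n) f≗g =
  cong₂ _+_ (sumN-cong n (λ l l<n → f≗g l (ℕₚ.m<n⇒m<1+n l<n))) (f≗g n ℕₚ.≤-refl)

sumN-zero : ∀ n (f : ℕ → ℚ) → (∀ l → f l ≡ 0ℚ) → sumN n f ≡ 0ℚ
sumN-zero zero    f f≗0 = refl
sumN-zero (suc n) f f≗0 = cong₂ _+_ (sumN-zero n f f≗0) (f≗0 n)

-- Shift and backward difference on sequences

infix 4 _≐_
_≐_ : Series → Series → Set
A ≐ B = ∀ n → A n ≡ B n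

-- Multiplication by t.
shift : Series → Series
shift A zero    = 0ℚ
shift A (suc n) = A n

shift^ : ℕ → Series → Series
shift^ zero    A = A
shift^ (suc m) A = shift (shift^ m A)

-- Multiplication by 1 - t.
Δ : Series → Series
Δ A n = A n - shift A n

Δ^ : ℕ → Series → Series
Δ^ zero    A = A
Δ^ (suc m) A = Δ (Δ^ m A)

shift-cong : ∀ {A B} → A ≐ B → shift A ≐ shift B
shift-cong A≐B zero    = refl
shift-cong A≐B (suc n) = A≐B n

shift^-cong : ∀ m {A B} → A ≐ B → shift^ m A ≐ shift^ m B
shift^-cong zero    A≐B = A≐B
shift^-cong (suc m) A≐B = shift-cong (shift^-cong m A≐B)

shift^-< : ∀ i A x → x < i → shift^ i A x ≡ 0ℚ
shift^-< (suc i) A zero    _           = refl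
shift^-< (suc i) A (suc x) (s≤s x<i) = shift^-< i A x x<i

shift^-≥ : ∀ i A x → i ≤ x → shift^ i A x ≡ A (x ∸ i)
shift^-≥ zero    A x       _           = refl
shift^-≥ (suc i) A (suc x) (s≤s i≤x) = shift^-≥ i A x i≤x

Δ-cong : ∀ {A B} → A ≐ B → Δ A ≐ Δ B
Δ-cong A≐B n = cong₂ _-_ (A≐B n) (shift-cong A≐B n)

Δ^-cong : ∀ m {A B} → A ≐ B → Δ^ m A ≐ Δ^ m B
Δ^-cong zero    A≐B = A≐B
Δ^-cong (suc m) A≐B = Δ-cong (Δ^-cong m A≐B)

Δ^-+ : ∀ a b A → Δ^ a (Δ^ b A) ≐ Δ^ (a ℕ.+ b) A
Δ^-+ zero    b A n = refl
Δ^-+ (suc a) b A   = Δ-cong (Δ^-+ a b A)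

Δ^-Δ : ∀ m A → Δ^ m (Δ A) ≐ Δ^ (suc m) A
Δ^-Δ zero    A n = refl
Δ^-Δ (suc m) A   = Δ-cong (Δ^-Δ m A)

Δ^-shift : ∀ m A → Δ^ m (shift A) ≐ shift (Δ^ m A)
Δ^-shift zero    A n = refl
Δ^-shift (suc m) A n = trans (Δ-cong (Δ^-shift m A) n) (Δ-shift (Δ^ m A) n)
  where
    Δ-shift : ∀ A → Δ (shift A) ≐ shift (Δ A)
    Δ-shift A zero    = refl
    Δ-shift A (suc n) = refl

Δ^-shift^ : ∀ m i A → Δ^ m (shift^ i A) ≐ shift^ i (Δ^ m A)
Δ^-shift^ m zero    A n = refl
Δ^-shift^ m (suc i) A n = trans (Δ^-shift m (shift^ i A) n) (shift-cong (Δ^-shift^ m i A) n)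

Δ^-⊕ : ∀ m A B → Δ^ m (A ⊕ B) ≐ Δ^ m A ⊕ Δ^ m B
Δ^-⊕ zero    A B n = refl
Δ^-⊕ (suc m) A B n = trans (Δ-cong (Δ^-⊕ m A B) n) (Δ-⊕ (Δ^ m A) (Δ^ m B) n)
  where
    Δ-⊕ : ∀ A B → Δ (A ⊕ B) ≐ Δ A ⊕ Δ B
    Δ-⊕ A B zero    = solve 2 (λ a b → (a :+ b) :- con 0ℚ := (a :- con 0ℚ) :+ (b :- con 0ℚ))
                        refl (A 0) (B 0)
    Δ-⊕ A B (suc n) = solve 4 (λ a b c d → (a :+ b) :- (c :+ d) := (a :- c) :+ (b :- d))
                        refl (A (suc n)) (B (suc n)) (A n) (B n)

Δ^-scale : ∀ m c A → Δ^ m (scale c A) ≐ scale c (Δ^ m A)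
Δ^-scale zero    c A n = refl
Δ^-scale (suc m) c A n = trans (Δ-cong (Δ^-scale m c A) n) (Δ-scale c (Δ^ m A) n)
  where
    Δ-scale : ∀ c A → Δ (scale c A) ≐ scale c (Δ A)
    Δ-scale c A zero    = solve 2 (λ c a → c :* a :- con 0ℚ := c :* (a :- con 0ℚ)) refl c (A 0)
    Δ-scale c A (suc n) = solve 3 (λ c a b → c :* a :- c :* b := c :* (a :- b)) refl c (A (suc n)) (A n)

Δ^-sumN : ∀ m c (F : ℕ → Series) →
  Δ^ m (λ d → sumN c (λ l → F l d)) ≐ (λ d → sumN c (λ l → Δ^ m (F l) d))
Δ^-sumN m zero    F = Δ^-zero m
  where
    Δ^-zero : ∀ m → Δ^ m (λ _ → 0ℚ) ≐ (λ _ → 0ℚ)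
    Δ^-zero zero    n       = refl
    Δ^-zero (suc m) zero    = cong (_- 0ℚ) (Δ^-zero m 0)
    Δ^-zero (suc m) (suc n) = cong₂ _-_ (Δ^-zero m (suc n)) (Δ^-zero m n)
Δ^-sumN m (suc c) F n = trans (Δ^-⊕ m (λ d → sumN c (λ l → F l d)) (F c) n)
  (cong (_+ Δ^ m (F c) n) (Δ^-sumN m c F n))

⊗-congˡ : ∀ {P Q} A → P ≐ Q → (P ⊗ A) ≐ (Q ⊗ A)
⊗-congˡ A P≐Q n = sumTo-cong n (λ l _ → cong (_* A (n ∸ l)) (P≐Q l))

⊗-distribˡ-⊕ : ∀ P A B → (P ⊗ (A ⊕ B)) ≐ (P ⊗ A) ⊕ (P ⊗ B)
⊗-distribˡ-⊕ P A B n =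
  trans (sumTo-cong n (λ l _ → *-distribˡ-+ (P l) (A (n ∸ l)) (B (n ∸ l)))) (sumTo-+ n _ _)

⊗-oneˡ : ∀ A → (const 1ℚ ⊗ A) ≐ A
⊗-oneˡ A zero    = *-identityˡ (A 0)
⊗-oneˡ A (suc m) = begin
    sumTo (suc m) (λ l → const 1ℚ l * A (suc m ∸ l))
  ≡⟨ sumTo-first m _ ⟩
    1ℚ * A (suc m) + sumTo m (λ l → 0ℚ * A (m ∸ l))
  ≡⟨ cong₂ _+_ (*-identityˡ (A (suc m))) (sumTo-zero m _ (λ l _ → *-zeroˡ (A (m ∸ l)))) ⟩
    A (suc m) + 0ℚ
  ≡⟨ +-identityʳ _ ⟩
    A (suc m) ∎
  where open ≡-Reasoning

const-high : ∀ a n → 0 < n → const a n ≡ 0ℚ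
const-high a (suc n) _ = refl

X-high : ∀ n → 0 < n → X (suc n) ≡ 0ℚ
X-high (suc n) _ = refl

⊗-const : ∀ P a → (P ⊗ const a) ≐ scale a P
⊗-const P a n = begin
    sumTo n (λ l → P l * const a (n ∸ l))
  ≡⟨ sumTo-last n _ (λ l l<n → trans (cong (P l *_) (const-high a (n ∸ l) (ℕₚ.m<n⇒0<n∸m l<n)))
                                      (*-zeroʳ (P l))) ⟩
    P n * const a (n ∸ n)
  ≡⟨ cong (λ m → P n * const a m) (ℕₚ.n∸n≡0 n) ⟩
    P n * a
  ≡⟨ *-comm (P n) a ⟩
    a * P n ∎
  where open ≡-Reasoning

⊗-shiftˡ : ∀ P A → (shift P ⊗ A) ≐ shift (P ⊗ A)
⊗-shiftˡ P A zero    = *-zeroˡ (A 0)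
⊗-shiftˡ P A (suc m) = begin
    sumTo (suc m) (λ l → shift P l * A (suc m ∸ l))
  ≡⟨ sumTo-first m _ ⟩
    0ℚ * A (suc m) + (P ⊗ A) m
  ≡⟨ cong (_+ (P ⊗ A) m) (*-zeroˡ (A (suc m))) ⟩
    0ℚ + (P ⊗ A) m
  ≡⟨ +-identityˡ _ ⟩
    (P ⊗ A) m ∎
  where open ≡-Reasoning

⊗-X : ∀ P → (P ⊗ X) ≐ shift P
⊗-X P zero    = *-zeroʳ (P 0)
⊗-X P (suc m) = begin
    sumTo m f + P (suc m) * X (m ∸ m)
  ≡⟨ cong₂ _+_ (sumTo-last m f below)
               (trans (cong (λ j → P (suc m) * X j) (ℕₚ.n∸n≡0 m)) (*-zeroʳ (P (suc m)))) ⟩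
    P m * X (suc m ∸ m) + 0ℚ
  ≡⟨ cong (λ j → P m * X j + 0ℚ) (ℕₚ.m+n∸n≡m 1 m) ⟩
    P m * 1ℚ + 0ℚ
  ≡⟨ trans (+-identityʳ _) (*-identityʳ (P m)) ⟩
    P m ∎
  where
    open ≡-Reasoning
    f : ℕ → ℚ
    f l = P l * X (suc m ∸ l)
    below : ∀ l → l < m → f l ≡ 0ℚ
    below l l<m = begin
        P l * X (suc m ∸ l)
      ≡⟨ cong (λ j → P l * X j) (ℕₚ.+-∸-assoc 1 (ℕₚ.<⇒≤ l<m)) ⟩
        P l * X (suc (m ∸ l))
      ≡⟨ cong (P l *_) (X-high (m ∸ l) (ℕₚ.m<n⇒0<n∸m l<m)) ⟩
        P l * 0ℚ
      ≡⟨ *-zeroʳ (P l) ⟩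
        0ℚ ∎

⊗-Δˡ : ∀ P A → (Δ P ⊗ A) ≐ Δ (P ⊗ A)
⊗-Δˡ P A n = begin
    sumTo n (λ l → (P l - shift P l) * A (n ∸ l))
  ≡⟨ sumTo-cong n (λ l _ → solve 3 (λ p q a → (p :- q) :* a := p :* a :+ (:- con 1ℚ) :* (q :* a))
                             refl (P l) (shift P l) (A (n ∸ l))) ⟩
    sumTo n (λ l → P l * A (n ∸ l) + (- 1ℚ) * (shift P l * A (n ∸ l)))
  ≡⟨ sumTo-+ n _ _ ⟩
    (P ⊗ A) n + sumTo n (λ l → (- 1ℚ) * (shift P l * A (n ∸ l)))
  ≡⟨ cong (λ z → (P ⊗ A) n + z) (sumTo-* n (- 1ℚ) _) ⟩
    (P ⊗ A) n + (- 1ℚ) * (shift P ⊗ A) n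
  ≡⟨ cong (λ z → (P ⊗ A) n + (- 1ℚ) * z) (⊗-shiftˡ P A n) ⟩
    (P ⊗ A) n + (- 1ℚ) * shift (P ⊗ A) n
  ≡⟨ solve 2 (λ x y → x :+ (:- con 1ℚ) :* y := x :- y) refl ((P ⊗ A) n) (shift (P ⊗ A) n) ⟩
    Δ (P ⊗ A) n ∎
  where open ≡-Reasoning

pow-oneMinusT : ∀ m A → (pow oneMinusT m ⊗ A) ≐ Δ^ m A
pow-oneMinusT zero    A = ⊗-oneˡ A
pow-oneMinusT (suc m) A n = begin
    ((oneMinusT ⊗ pow oneMinusT m) ⊗ A) n
  ≡⟨ ⊗-congˡ A (oneMinusT-⊗ (pow oneMinusT m)) n ⟩
    (Δ (pow oneMinusT m) ⊗ A) n
  ≡⟨ ⊗-Δˡ (pow oneMinusT m) A n ⟩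
    Δ (pow oneMinusT m ⊗ A) n
  ≡⟨ Δ-cong (pow-oneMinusT m A) n ⟩
    Δ^ (suc m) A n ∎
  where
    open ≡-Reasoning
    oneMinusT≐Δ1 : oneMinusT ≐ Δ (const 1ℚ)
    oneMinusT≐Δ1 zero          = refl
    oneMinusT≐Δ1 (suc zero)    = refl
    oneMinusT≐Δ1 (suc (suc n)) = refl
    oneMinusT-⊗ : ∀ B → (oneMinusT ⊗ B) ≐ Δ B
    oneMinusT-⊗ B n = trans (⊗-congˡ B oneMinusT≐Δ1 n)
      (trans (⊗-Δˡ (const 1ℚ) B n) (Δ-cong (⊗-oneˡ B) n))

pow-X : ∀ i → pow X i ≐ shift^ i (const 1ℚ)
pow-X zero    n = refl
pow-X (suc i) n = begin
    (X ⊗ pow X i) n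
  ≡⟨ ⊗-congˡ (pow X i) X≐shift1 n ⟩
    (shift (const 1ℚ) ⊗ pow X i) n
  ≡⟨ ⊗-shiftˡ (const 1ℚ) (pow X i) n ⟩
    shift (const 1ℚ ⊗ pow X i) n
  ≡⟨ shift-cong (λ m → trans (⊗-oneˡ (pow X i) m) (pow-X i m)) n ⟩
    shift^ (suc i) (const 1ℚ) n ∎
  where
    open ≡-Reasoning
    X≐shift1 : X ≐ shift (const 1ℚ)
    X≐shift1 zero          = refl
    X≐shift1 (suc zero)    = refl
    X≐shift1 (suc (suc n)) = refl

-- Evaluating polynomials at natural numbers

-- P(x) = Σ_{j ≤ N} P_j x^j, meaningful when P has degree at most N.
ev : ℕ → Series → ℕ → ℚ
ev N P x = sumTo N (λ j → P j * fromℕ (x ℕ.^ j))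

Deg : ℕ → Series → Set
Deg N P = ∀ j → N < j → P j ≡ 0ℚ

ev-cong : ∀ N {P Q} x → P ≐ Q → ev N P x ≡ ev N Q x
ev-cong N x P≐Q = sumTo-cong N (λ j _ → cong (_* fromℕ (x ℕ.^ j)) (P≐Q j))

ev-⊕ : ∀ N P Q x → ev N (P ⊕ Q) x ≡ ev N P x + ev N Q x
ev-⊕ N P Q x = trans (sumTo-cong N (λ j _ → *-distribʳ-+ _ (P j) (Q j))) (sumTo-+ N _ _)

ev-scale : ∀ N c P x → ev N (scale c P) x ≡ c * ev N P x
ev-scale N c P x = trans (sumTo-cong N (λ j _ → *-assoc c (P j) _)) (sumTo-* N c _)

ev-shift : ∀ N P x → ev (suc N) (shift P) x ≡ fromℕ x * ev N P x
ev-shift N P x = begin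
    sumTo (suc N) (λ j → shift P j * fromℕ (x ℕ.^ j))
  ≡⟨ sumTo-first N _ ⟩
    0ℚ * fromℕ 1 + sumTo N (λ j → P j * fromℕ (x ℕ.* x ℕ.^ j))
  ≡⟨ cong₂ _+_ (*-zeroˡ (fromℕ 1)) (sumTo-cong N (λ j _ → pull-out j)) ⟩
    0ℚ + sumTo N (λ j → fromℕ x * (P j * fromℕ (x ℕ.^ j)))
  ≡⟨ +-identityˡ _ ⟩
    sumTo N (λ j → fromℕ x * (P j * fromℕ (x ℕ.^ j)))
  ≡⟨ sumTo-* N (fromℕ x) _ ⟩
    fromℕ x * ev N P x ∎
  where
    open ≡-Reasoning
    pull-out : ∀ j → P j * fromℕ (x ℕ.* x ℕ.^ j) ≡ fromℕ x * (P j * fromℕ (x ℕ.^ j))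
    pull-out j = trans (cong (P j *_) (fromℕ-* x (x ℕ.^ j)))
      (solve 3 (λ p a b → p :* (a :* b) := a :* (p :* b)) refl (P j) (fromℕ x) (fromℕ (x ℕ.^ j)))

ev-at0 : ∀ N P → ev N P 0 ≡ P 0
ev-at0 zero    P = *-identityʳ (P 0)
ev-at0 (suc N) P = trans (cong₂ _+_ (ev-at0 N P) (*-zeroʳ (P (suc N)))) (+-identityʳ (P 0))

ev-suc : ∀ N P x → Deg N P → ev (suc N) P x ≡ ev N P x
ev-suc N P x deg = begin
    ev N P x + P (suc N) * fromℕ (x ℕ.^ suc N)
  ≡⟨ cong (λ z → ev N P x + z * fromℕ (x ℕ.^ suc N)) (deg (suc N) ℕₚ.≤-refl) ⟩
    ev N P x + 0ℚ * fromℕ (x ℕ.^ suc N)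
  ≡⟨ trans (cong (λ z → ev N P x + z) (*-zeroˡ (fromℕ (x ℕ.^ suc N)))) (+-identityʳ _) ⟩
    ev N P x ∎
  where open ≡-Reasoning

⊗-linear : ∀ P a → (P ⊗ (X ⊕ const a)) ≐ shift P ⊕ scale a P
⊗-linear P a n = trans (⊗-distribˡ-⊕ P X (const a) n) (cong₂ _+_ (⊗-X P n) (⊗-const P a n))

Deg-⊗-linear : ∀ N P a → Deg N P → Deg (suc N) (P ⊗ (X ⊕ const a))
Deg-⊗-linear N P a deg (suc j) (s≤s N<j) = begin
    (P ⊗ (X ⊕ const a)) (suc j)
  ≡⟨ ⊗-linear P a (suc j) ⟩
    P j + a * P (suc j)
  ≡⟨ cong₂ (λ u v → u + a * v) (deg j N<j) (deg (suc j) (ℕₚ.m<n⇒m<1+n N<j)) ⟩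
    0ℚ + a * 0ℚ
  ≡⟨ trans (+-identityˡ _) (*-zeroʳ a) ⟩
    0ℚ ∎
  where open ≡-Reasoning

ev-⊗-linear : ∀ N P a x → Deg N P → ev (suc N) (P ⊗ (X ⊕ const a)) x ≡ (fromℕ x + a) * ev N P x
ev-⊗-linear N P a x deg = begin
    ev (suc N) (P ⊗ (X ⊕ const a)) x
  ≡⟨ ev-cong (suc N) x (⊗-linear P a) ⟩
    ev (suc N) (shift P ⊕ scale a P) x
  ≡⟨ ev-⊕ (suc N) (shift P) (scale a P) x ⟩
    ev (suc N) (shift P) x + ev (suc N) (scale a P) x
  ≡⟨ cong₂ _+_ (ev-shift N P x) (trans (ev-scale (suc N) a P x) (cong (a *_) (ev-suc N P x deg))) ⟩
    fromℕ x * ev N P x + a * ev N P x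
  ≡⟨ *-distribʳ-+ (ev N P x) (fromℕ x) a ⟨
    (fromℕ x + a) * ev N P x ∎
  where open ≡-Reasoning

prodQ : ℕ → (ℕ → ℚ) → ℚ
prodQ zero    f = 1ℚ
prodQ (suc n) f = prodQ n f * f n

prodQ-cong : ∀ n {f g : ℕ → ℚ} → (∀ m → f m ≡ g m) → prodQ n f ≡ prodQ n g
prodQ-cong zero    f≗g = refl
prodQ-cong (suc n) f≗g = cong₂ _*_ (prodQ-cong n f≗g) (f≗g n)

Deg-prod : ∀ n (a : ℕ → ℚ) → Deg n (prodSeries n (λ m → X ⊕ const (a m)))
Deg-prod zero    a (suc j) _ = refl
Deg-prod (suc n) a = Deg-⊗-linear n _ (a n) (Deg-prod n a)

ev-prod : ∀ n (a : ℕ → ℚ) x →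
  ev n (prodSeries n (λ m → X ⊕ const (a m))) x ≡ prodQ n (λ m → fromℕ x + a m)
ev-prod zero    a x = refl
ev-prod (suc n) a x = begin
    ev (suc n) (prodSeries n F ⊗ F n) x
  ≡⟨ ev-⊗-linear n _ (a n) x (Deg-prod n a) ⟩
    (fromℕ x + a n) * ev n (prodSeries n F) x
  ≡⟨ cong ((fromℕ x + a n) *_) (ev-prod n a x) ⟩
    (fromℕ x + a n) * prodQ n (λ m → fromℕ x + a m)
  ≡⟨ *-comm (fromℕ x + a n) _ ⟩
    prodQ (suc n) (λ m → fromℕ x + a m) ∎
  where
    open ≡-Reasoning
    F : ℕ → Series
    F m = X ⊕ const (a m)

-- Binomial coefficients and Pascal's rule

ff : ℕ → ℚ → ℚ
ff n y = prodQ n (λ m → y - fromℕ m)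

choose : ℕ → ℚ → ℚ
choose n y = invFact n * ff n y

ff-vanishes : ∀ n y → y < n → ff n (fromℕ y) ≡ 0ℚ
ff-vanishes (suc n) y y<1+n with y ℕ.≟ n
... | yes refl = trans (cong (ff n (fromℕ y) *_) (+-inverseʳ (fromℕ y))) (*-zeroʳ (ff n (fromℕ y)))
... | no y≢n   = trans (cong (_* (fromℕ y - fromℕ n)) (ff-vanishes n y (ℕₚ.≤∧≢⇒< (ℕₚ.≤-pred y<1+n) y≢n)))
                       (*-zeroˡ (fromℕ y - fromℕ n))

choose-vanishes : ∀ n y → y < n → choose n (fromℕ y) ≡ 0ℚ
choose-vanishes n y y<n = trans (cong (invFact n *_) (ff-vanishes n y y<n)) (*-zeroʳ (invFact n))

ff-shift : ∀ n y → ff (suc n) (y + 1ℚ) ≡ (y + 1ℚ) * ff n y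
ff-shift zero    y = solve 1 (λ y → con 1ℚ :* ((y :+ con 1ℚ) :- con 0ℚ) := (y :+ con 1ℚ) :* con 1ℚ) refl y
ff-shift (suc n) y = begin
    ff (suc n) (y + 1ℚ) * ((y + 1ℚ) - fromℕ (suc n))
  ≡⟨ cong₂ (λ u v → u * ((y + 1ℚ) - v)) (ff-shift n y) (fromℕ-suc n) ⟩
    (y + 1ℚ) * ff n y * ((y + 1ℚ) - (fromℕ n + 1ℚ))
  ≡⟨ solve 3 (λ y f m → (y :+ con 1ℚ) :* f :* ((y :+ con 1ℚ) :- (m :+ con 1ℚ))
                      := (y :+ con 1ℚ) :* (f :* (y :- m))) refl y (ff n y) (fromℕ n) ⟩
    (y + 1ℚ) * (ff n y * (y - fromℕ n)) ∎
  where open ≡-Reasoning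

pascal : ∀ n y → choose (suc n) (y + 1ℚ) - choose (suc n) y ≡ choose n y
pascal n y = begin
    c * ff (suc n) (y + 1ℚ) - c * (ff n y * (y - fromℕ n))
  ≡⟨ cong (λ z → c * z - c * (ff n y * (y - fromℕ n))) (ff-shift n y) ⟩
    c * ((y + 1ℚ) * ff n y) - c * (ff n y * (y - fromℕ n))
  ≡⟨ solve 4 (λ c y f m → c :* ((y :+ con 1ℚ) :* f) :- c :* (f :* (y :- m))
                        := (m :+ con 1ℚ) :* c :* f) refl c y (ff n y) (fromℕ n) ⟩
    (fromℕ n + 1ℚ) * c * ff n y
  ≡⟨ cong (λ z → z * c * ff n y) (fromℕ-suc n) ⟨
    fromℕ (suc n) * c * ff n y
  ≡⟨ cong (_* ff n y) (invFact-suc n) ⟩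
    choose n y ∎
  where
    open ≡-Reasoning
    c = invFact (suc n)

-- The binomial sequence  H_n(e) = binom(e+n, n), the coefficients of (1-t)^{-(n+1)}.
binomSeq : ℕ → Series
binomSeq n e = choose n (fromℕ (e ℕ.+ n))

Δ-binomSeq : ∀ n → Δ (binomSeq (suc n)) ≐ binomSeq n
Δ-binomSeq n zero = begin
    choose (suc n) (fromℕ (suc n)) - 0ℚ
  ≡⟨ cong₂ (λ u v → choose (suc n) u - v) (fromℕ-suc n) (sym (choose-vanishes (suc n) n ℕₚ.≤-refl)) ⟩
    choose (suc n) (fromℕ n + 1ℚ) - choose (suc n) (fromℕ n)
  ≡⟨ pascal n (fromℕ n) ⟩
    choose n (fromℕ n) ∎
  where open ≡-Reasoning
Δ-binomSeq n (suc e) = begin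
    choose (suc n) (fromℕ (suc (e ℕ.+ suc n))) - choose (suc n) y
  ≡⟨ cong (λ u → choose (suc n) u - choose (suc n) y) (fromℕ-suc (e ℕ.+ suc n)) ⟩
    choose (suc n) (y + 1ℚ) - choose (suc n) y
  ≡⟨ pascal n y ⟩
    choose n y
  ≡⟨ cong (λ m → choose n (fromℕ m)) (ℕₚ.+-suc e n) ⟩
    binomSeq n (suc e) ∎
  where
    open ≡-Reasoning
    y = fromℕ (e ℕ.+ suc n)

Δ^-binomSeq : ∀ n → Δ^ (suc n) (binomSeq n) ≐ const 1ℚ
Δ^-binomSeq zero    zero    = refl
Δ^-binomSeq zero    (suc e) = refl
Δ^-binomSeq (suc n) e =
  trans (sym (Δ^-Δ (suc n) (binomSeq (suc n)) e))
        (trans (Δ^-cong (suc n) (Δ-binomSeq n) e) (Δ^-binomSeq n e))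

binomPoly-value : ∀ k i x → i ≤ k ∸ 1 →
  ev (k ∸ 1) (binomPoly k i) x ≡ choose (k ∸ 1) (fromℕ (x ℕ.+ (k ∸ 1) ∸ i))
binomPoly-value k i x i≤K = begin
    ev K (binomPoly k i) x
  ≡⟨ ev-scale K (invFact K) _ x ⟩
    invFact K * ev K (prodSeries K (λ m → X ⊕ const (a m))) x
  ≡⟨ cong (invFact K *_) (ev-prod K a x) ⟩
    invFact K * prodQ K (λ m → fromℕ x + a m)
  ≡⟨ cong (invFact K *_) (prodQ-cong K factor) ⟩
    choose K (fromℕ y) ∎
  where
    open ≡-Reasoning
    K = k ∸ 1
    a : ℕ → ℚ
    a m = fromℕ K - fromℕ i - fromℕ m
    y = x ℕ.+ K ∸ i
    x+K-i : fromℕ x + fromℕ K - fromℕ i ≡ fromℕ y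
    x+K-i = begin
        fromℕ x + fromℕ K - fromℕ i
      ≡⟨ cong (_- fromℕ i) (fromℕ-+ x K) ⟨
        fromℕ (x ℕ.+ K) - fromℕ i
      ≡⟨ cong (λ v → fromℕ v - fromℕ i) (ℕₚ.m∸n+n≡m (ℕₚ.≤-trans i≤K (ℕₚ.m≤n+m K x))) ⟨
        fromℕ (y ℕ.+ i) - fromℕ i
      ≡⟨ cong (_- fromℕ i) (fromℕ-+ y i) ⟩
        fromℕ y + fromℕ i - fromℕ i
      ≡⟨ solve 2 (λ u v → u :+ v :- v := u) refl (fromℕ y) (fromℕ i) ⟩
        fromℕ y ∎
    factor : ∀ m → fromℕ x + a m ≡ fromℕ y - fromℕ m
    factor m = trans
      (solve 4 (λ x k i m → x :+ (k :- i :- m) := (x :+ k :- i) :- m) refl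
        (fromℕ x) (fromℕ K) (fromℕ i) (fromℕ m))
      (cong (_- fromℕ m) x+K-i)

choose-shift : ∀ K i x → i ≤ K → choose K (fromℕ (x ℕ.+ K ∸ i)) ≡ shift^ i (binomSeq K) x
choose-shift K i x i≤K with x ℕ.<? i
... | yes x<i = trans (choose-vanishes K _ x+K-i<K) (sym (shift^-< i (binomSeq K) x x<i))
  where
    x+K-i<K : x ℕ.+ K ∸ i < K
    x+K-i<K = ℕₚ.≤-trans (ℕₚ.∸-monoˡ-< (ℕₚ.+-monoˡ-< K x<i) (ℕₚ.≤-trans i≤K (ℕₚ.m≤n+m K x)))
                         (ℕₚ.≤-reflexive (ℕₚ.m+n∸m≡n i K))
... | no x≮i = begin
    choose K (fromℕ (x ℕ.+ K ∸ i))
  ≡⟨ cong (λ m → choose K (fromℕ m)) (ℕₚ.+-∸-comm K i≤x) ⟩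
    binomSeq K (x ∸ i)
  ≡⟨ shift^-≥ i (binomSeq K) x i≤x ⟨
    shift^ i (binomSeq K) x ∎
  where
    open ≡-Reasoning
    i≤x = ℕₚ.≮⇒≥ x≮i

binomPoly-at0 : ∀ k i → 1 ≤ i → i ≤ k ∸ 1 → binomPoly k i 0 ≡ 0ℚ
binomPoly-at0 k i 1≤i i≤K = begin
    binomPoly k i 0
  ≡⟨ ev-at0 (k ∸ 1) (binomPoly k i) ⟨
    ev (k ∸ 1) (binomPoly k i) 0
  ≡⟨ binomPoly-value k i 0 i≤K ⟩
    choose (k ∸ 1) (fromℕ (k ∸ 1 ∸ i))
  ≡⟨ choose-shift (k ∸ 1) i 0 i≤K ⟩
    shift^ i (binomSeq (k ∸ 1)) 0
  ≡⟨ shift^-< i (binomSeq (k ∸ 1)) 0 1≤i ⟩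
    0ℚ ∎
  where open ≡-Reasoning

b-coefficient : ∀ k i j → b k i j * invFact j ≡ binomPoly k i j
b-coefficient k i j = begin
    fromℕ (j !) * β * invFact j
  ≡⟨ solve 3 (λ f β c → f :* β :* c := c :* f :* β) refl (fromℕ (j !)) β (invFact j) ⟩
    invFact j * fromℕ (j !) * β
  ≡⟨ cong (_* β) (invFact-inverse j) ⟩
    1ℚ * β
  ≡⟨ *-identityˡ β ⟩
    β ∎
  where
    open ≡-Reasoning
    β = binomPoly k i j

ev-eulerGF : ∀ N P → P 0 ≡ 0ℚ → ∀ d →
  sumN N (λ l → P (suc l) * eulerGF (2 ℕ.+ l) d) ≡ ev N P d
ev-eulerGF N P P0≡0 zero = trans (sumN-zero N _ (λ l → *-zeroʳ (P (suc l))))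
                                 (sym (trans (ev-at0 N P) P0≡0))
ev-eulerGF N P P0≡0 (suc d) = begin
    sumN N (λ l → P (suc l) * fromℕ (suc d ℕ.^ suc l))
  ≡⟨ +-identityˡ _ ⟨
    0ℚ + sumN N (λ l → P (suc l) * fromℕ (suc d ℕ.^ suc l))
  ≡⟨ cong (λ z → z + sumN N (λ l → P (suc l) * fromℕ (suc d ℕ.^ suc l)))
          (trans (cong (_* fromℕ 1) P0≡0) (*-zeroˡ (fromℕ 1))) ⟨
    P 0 * fromℕ 1 + sumN N (λ l → P (suc l) * fromℕ (suc d ℕ.^ suc l))
  ≡⟨ sumTo-sumN N (λ j → P j * fromℕ (suc d ℕ.^ j)) ⟨
    ev N P (suc d) ∎
  where open ≡-Reasoning

b-generating : ∀ k i → 1 ≤ i → i ≤ k ∸ 1 →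
  (λ d → sumN (k ∸ 1) (λ l → b k i (suc l) * invFact (suc l) * eulerGF (2 ℕ.+ l) d))
    ≐ shift^ i (binomSeq (k ∸ 1))
b-generating k i 1≤i i≤K d = begin
    sumN K (λ l → b k i (suc l) * invFact (suc l) * eulerGF (2 ℕ.+ l) d)
  ≡⟨ sumN-cong K (λ l _ → cong (_* eulerGF (2 ℕ.+ l) d) (b-coefficient k i (suc l))) ⟩
    sumN K (λ l → binomPoly k i (suc l) * eulerGF (2 ℕ.+ l) d)
  ≡⟨ ev-eulerGF K (binomPoly k i) (binomPoly-at0 k i 1≤i i≤K) d ⟩
    ev K (binomPoly k i) d
  ≡⟨ binomPoly-value k i d i≤K ⟩
    choose K (fromℕ (d ℕ.+ K ∸ i))
  ≡⟨ choose-shift K i d i≤K ⟩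
    shift^ i (binomSeq K) d ∎
  where
    open ≡-Reasoning
    K = k ∸ 1

-- The summands as k-th differences

summand-as-difference : ∀ k j c → j ≤ k →
  scale c (pow oneMinusT (k ∸ j) ⊗ QE j) ≐ Δ^ k (scale (c * invFact (j ∸ 1)) (eulerGF j))
summand-as-difference k j c j≤k n = begin
    c * (pow oneMinusT (k ∸ j) ⊗ QE j) n
  ≡⟨ cong (c *_) (pow-oneMinusT (k ∸ j) (QE j) n) ⟩
    c * Δ^ (k ∸ j) (QE j) n
  ≡⟨ cong (c *_) (Δ^-cong (k ∸ j) (λ d → cong (e *_) (pow-oneMinusT j E d)) n) ⟩
    c * Δ^ (k ∸ j) (scale e (Δ^ j E)) n
  ≡⟨ cong (c *_) (Δ^-scale (k ∸ j) e (Δ^ j E) n) ⟩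
    c * (e * Δ^ (k ∸ j) (Δ^ j E) n)
  ≡⟨ cong (λ z → c * (e * z)) (trans (Δ^-+ (k ∸ j) j E n) (cong (λ m → Δ^ m E n) (ℕₚ.m∸n+n≡m j≤k))) ⟩
    c * (e * Δ^ k E n)
  ≡⟨ *-assoc c e _ ⟨
    c * e * Δ^ k E n
  ≡⟨ Δ^-scale k (c * e) E n ⟨
    Δ^ k (scale (c * e) E) n ∎
  where
    open ≡-Reasoning
    e = invFact (j ∸ 1)
    E = eulerGF j

mainTheorem4 : (k : ℕ) → 2 ≤ k → (i : ℕ) → 1 ≤ i → i ≤ k ∸ 1 →
    ∀ (n : ℕ) →
      pow X i n
        ≡ sumSeries 2 k (λ j → scale (b k i (j ∸ 1)) (pow oneMinusT (k ∸ j) ⊗ QE j)) n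
mainTheorem4 k@(suc K) (s≤s _) i 1≤i i≤K n = sym (begin
    sumN K (λ l → scale (b k i (suc l)) (pow oneMinusT (k ∸ (2 ℕ.+ l)) ⊗ QE (2 ℕ.+ l)) n)
  ≡⟨ sumN-cong K (λ l l<K → summand-as-difference k (2 ℕ.+ l) (b k i (suc l)) (s≤s l<K) n) ⟩
    sumN K (λ l → Δ^ k (F l) n)
  ≡⟨ Δ^-sumN k K F n ⟨
    Δ^ k (λ d → sumN K (λ l → F l d)) n
  ≡⟨ Δ^-cong k (b-generating k i 1≤i i≤K) n ⟩
    Δ^ k (shift^ i (binomSeq K)) n
  ≡⟨ Δ^-shift^ k i (binomSeq K) n ⟩
    shift^ i (Δ^ k (binomSeq K)) n
  ≡⟨ shift^-cong i (Δ^-binomSeq K) n ⟩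
    shift^ i (const 1ℚ) n
  ≡⟨ pow-X i n ⟨
    pow X i n ∎)
  where
    open ≡-Reasoning
    F : ℕ → Series
    F l = scale (b k i (suc l) * invFact (suc l)) (eulerGF (2 ℕ.+ l))
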